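{- Let $n \in \{0,1,2,\ldots\}$, $a, b \in \mathbb{C}$, and suppose $b$ is not a negative integer. Then \[ \frac{1}{2n+b+2}\sum_{j=0}^{n} \sum_{i=0}^j \frac{\binom{2n+a+2}{i}}{\binom{2n+b+1}{j}} = \sum_{k=0}^n \frac{1}{(k+1)\binom{2k+b+2}{k+1}}\left(\binom{2k+a}{k}+\frac{b \,\sum_{j=0}^{k-1} \binom{2k+a}{j}}{k+b+1} \right). \]
   Context: For $x\in\mathbb{C}$ and a nonnegative integer $k$, the binomial coefficient is $\binom{x}{k}=\frac{x(x-1)\cdots(x-k+1)}{k!}$ (equal to $1$ when $k=0$). An empty sum (e.g. $\sum_{j=0}^{ -1}$) equals $0$. -}

module Defs where

open import Level using (Level; _⊔_) renaming (suc to lsuc)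
open import Data.Nat.Base using (ℕ; zero; suc; _!)
open import Algebra.Bundles using (CommutativeRing)
open import Relation.Nullary using (¬_)

ιR : ∀ {c ℓ} (R : CommutativeRing c ℓ) → ℕ → CommutativeRing.Carrier R
ιR R zero    = CommutativeRing.0# R
ιR R (suc n) = CommutativeRing._+_ R (ιR R n) (CommutativeRing.1# R)

-- A field of characteristic zero (the complex numbers being the case of
-- interest). The inverse is a total function, specified only on nonzero
-- elements (its value at 0 is irrelevant; all denominators occurring in the
-- theorem are nonzero under its hypotheses).
record CharZeroField (c ℓ : Level) : Set (lsuc (c ⊔ ℓ)) where
  field
    commutativeRing : CommutativeRing c ℓ
  open CommutativeRing commutativeRing public
  field
    _⁻¹      : Carrier → Carrier
    inverseʳ : ∀ x → ¬ (x ≈ 0#) → x * (x ⁻¹) ≈ 1#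
    charZero : ∀ m → ¬ (ιR commutativeRing (suc m) ≈ 0#)

  ι : ℕ → Carrier
  ι = ιR commutativeRing

  sumTo : ℕ → (ℕ → Carrier) → Carrier
  sumTo zero    f = 0#
  sumTo (suc n) f = sumTo n f + f n

  falling : Carrier → ℕ → Carrier
  falling x zero    = 1#
  falling x (suc k) = falling x k * (x - ι k)

  binom : Carrier → ℕ → Carrier
  binom x k = falling x k * (ι (k !) ⁻¹)

  NotNegInt : Carrier → Set ℓ
  NotNegInt x = ∀ m → ¬ (x ≈ - ι (suc m))

module Submission where

-- With  partial x j = Σ_{i≤j} C(x,i)  and
-- weighted x y n = Σ_{j≤n} partial x j / C(y,j),  Pascal's rule for
-- reciprocals,  (y+2)/C(y,j) = (y+1) (1/C(y+1,j) + 1/C(y+1,j+1)),  summed by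
-- parts against Pascal's rule for the partial sums gives the shift rule
--   (y+2) weighted x y n = (y+1) (weighted (x+1) (y+1) n + partial x n / C(y+1,n+1)).
-- Passing from n to n+1 shifts x and y by 2, so two applications of the
-- shift rule express the left-hand side at n+1 as the one at n plus three
-- explicit terms.  Evaluating their reciprocal binomials against a single
-- common denominator (via descent and absorption) reduces the claim that
-- these terms sum to the (n+1)-st summand on the right to a polynomial
-- identity.

open import Defs
open import Data.Nat using (ℕ; suc) renaming (_+_ to _+ℕ_; _*_ to _*ℕ_)
open import Data.Nat as ℕ using (zero; _≤_; _<_; s≤s; _!; _∸_)
import Data.Nat.Properties as ℕP
open import Data.Nat.Tactic.RingSolver using (solve-∀)
open import Data.Integer as ℤ using (ℤ; +_; -[1+_]; ∣_∣; sign; _◃_)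
import Data.Integer.Properties as ℤP
open import Data.Sign as Sign using (Sign)
open import Data.Sum using (inj₁; inj₂)
open import Data.Maybe using (Maybe; just; nothing)
open import Relation.Nullary using (¬_; yes; no)
open import Relation.Binary.PropositionalEquality as ≡ using (_≡_)
open import Algebra.Bundles using (CommutativeRing)
open import Algebra.Solver.Ring.AlmostCommutativeRing
  using (fromCommutativeRing; _-Raw-AlmostCommutative⟶_)

-- The standard library's ring solver (Algebra.Solver.Ring) normalises
-- polynomials whose constants live in a coefficient ring mapped
-- homomorphically into the target ring.  An abstract commutative ring has
-- no decidable equality, so we take integer coefficients and construct the
-- canonical homomorphism ℤ → R.
module IntegerCoefficients {c ℓ} (R : CommutativeRing c ℓ) where
  open CommutativeRing R
  open import Relation.Binary.Reasoning.Setoid setoid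
  open import Algebra.Properties.Ring ring using (-‿distribˡ-*; -‿distribʳ-*)
  open import Algebra.Properties.AbelianGroup +-abelianGroup using (⁻¹-anti-homo‿-; ⁻¹-∙-comm)
  open import Algebra.Properties.Group +-group using (⁻¹-involutive; ε⁻¹≈ε)

  private
    ι : ℕ → Carrier
    ι = ιR R

  ι-+ : ∀ m n → ι (m +ℕ n) ≈ ι m + ι n
  ι-+ zero    n = sym (+-identityˡ _)
  ι-+ (suc m) n = begin
    ι (m +ℕ n) + 1#   ≈⟨ +-congʳ (ι-+ m n) ⟩
    (ι m + ι n) + 1#  ≈⟨ +-assoc _ _ _ ⟩
    ι m + (ι n + 1#)  ≈⟨ +-congˡ (+-comm _ _) ⟩
    ι m + (1# + ι n)  ≈⟨ sym (+-assoc _ _ _) ⟩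
    (ι m + 1#) + ι n  ∎

  ι-* : ∀ m n → ι (m *ℕ n) ≈ ι m * ι n
  ι-* zero    n = sym (zeroˡ _)
  ι-* (suc m) n = begin
    ι (n +ℕ m *ℕ n)       ≈⟨ ι-+ n (m *ℕ n) ⟩
    ι n + ι (m *ℕ n)      ≈⟨ +-cong (sym (*-identityˡ _)) (ι-* m n) ⟩
    1# * ι n + ι m * ι n  ≈⟨ +-comm _ _ ⟩
    ι m * ι n + 1# * ι n  ≈⟨ sym (distribʳ _ _ _) ⟩
    (ι m + 1#) * ι n      ∎

  private
    ι-∸ : ∀ {m n} → n ≤ m → ι (m ∸ n) ≈ ι m - ι n
    ι-∸ {m} {n} n≤m = begin
      ι (m ∸ n)                 ≈⟨ sym (+-identityʳ _) ⟩
      ι (m ∸ n) + 0#            ≈⟨ +-congˡ (sym (-‿inverseʳ (ι n))) ⟩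
      ι (m ∸ n) + (ι n - ι n)   ≈⟨ sym (+-assoc _ _ _) ⟩
      (ι (m ∸ n) + ι n) - ι n   ≈⟨ +-congʳ (sym (ι-+ (m ∸ n) n)) ⟩
      ι (m ∸ n +ℕ n) - ι n      ≡⟨ ≡.cong (λ k → ι k - ι n) (ℕP.m∸n+n≡m n≤m) ⟩
      ι m - ι n                 ∎

    -- The image of an integer, defined through ι so that the
    -- homomorphism laws follow from those of ι.
    ⟦_⟧ℤ : ℤ → Carrier
    ⟦ + n      ⟧ℤ = ι n
    ⟦ -[1+ n ] ⟧ℤ = - ι (suc n)

    ⟦-⟧ℤ : ∀ i → ⟦ ℤ.- i ⟧ℤ ≈ - ⟦ i ⟧ℤ
    ⟦-⟧ℤ -[1+ n ]    = sym (⁻¹-involutive _)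
    ⟦-⟧ℤ (+ zero)    = sym ε⁻¹≈ε
    ⟦-⟧ℤ (+ (suc n)) = refl

    ⟦⊖⟧ℤ : ∀ m n → ⟦ m ℤ.⊖ n ⟧ℤ ≈ ι m - ι n
    ⟦⊖⟧ℤ m n with ℕP.≤-total n m
    ... | inj₁ n≤m = begin
      ⟦ m ℤ.⊖ n ⟧ℤ   ≡⟨ ≡.cong ⟦_⟧ℤ (ℤP.⊖-≥ n≤m) ⟩
      ι (m ∸ n)      ≈⟨ ι-∸ n≤m ⟩
      ι m - ι n      ∎
    ... | inj₂ m≤n = begin
      ⟦ m ℤ.⊖ n ⟧ℤ            ≡⟨ ≡.cong ⟦_⟧ℤ (ℤP.⊖-≤ m≤n) ⟩
      ⟦ ℤ.- (+ (n ∸ m)) ⟧ℤ    ≈⟨ ⟦-⟧ℤ (+ (n ∸ m)) ⟩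
      - ι (n ∸ m)             ≈⟨ -‿cong (ι-∸ m≤n) ⟩
      - (ι n - ι m)           ≈⟨ ⁻¹-anti-homo‿- _ _ ⟩
      ι m - ι n               ∎

    ⟦+⟧ℤ : ∀ i j → ⟦ i ℤ.+ j ⟧ℤ ≈ ⟦ i ⟧ℤ + ⟦ j ⟧ℤ
    ⟦+⟧ℤ -[1+ m ] -[1+ n ] = begin
      - ι (suc (suc (m +ℕ n)))    ≡⟨ ≡.cong (λ k → - ι (suc k)) (≡.sym (ℕP.+-suc m n)) ⟩
      - ι (suc m +ℕ suc n)        ≈⟨ -‿cong (ι-+ (suc m) (suc n)) ⟩
      - (ι (suc m) + ι (suc n))   ≈⟨ sym (⁻¹-∙-comm _ _) ⟩
      - ι (suc m) + - ι (suc n)   ∎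
    ⟦+⟧ℤ -[1+ m ] (+ n)    = trans (⟦⊖⟧ℤ n (suc m)) (+-comm _ _)
    ⟦+⟧ℤ (+ m)    -[1+ n ] = ⟦⊖⟧ℤ m (suc n)
    ⟦+⟧ℤ (+ m)    (+ n)    = ι-+ m n

    -- Multiplication goes through the decomposition  i = sign i ◃ ∣ i ∣.
    ⟦_⟧ₛ : Sign → Carrier
    ⟦ Sign.+ ⟧ₛ = 1#
    ⟦ Sign.- ⟧ₛ = - 1#

    ⟦*⟧ₛ : ∀ s t → ⟦ s Sign.* t ⟧ₛ ≈ ⟦ s ⟧ₛ * ⟦ t ⟧ₛ
    ⟦*⟧ₛ Sign.+ t      = sym (*-identityˡ _)
    ⟦*⟧ₛ Sign.- Sign.+ = sym (*-identityʳ _)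
    ⟦*⟧ₛ Sign.- Sign.- = begin
      1#              ≈⟨ sym (⁻¹-involutive _) ⟩
      - - 1#          ≈⟨ -‿cong (sym (*-identityʳ _)) ⟩
      - (- 1# * 1#)   ≈⟨ -‿distribʳ-* _ _ ⟩
      - 1# * - 1#     ∎

    ⟦◃⟧ℤ : ∀ s k → ⟦ s ◃ k ⟧ℤ ≈ ⟦ s ⟧ₛ * ι k
    ⟦◃⟧ℤ s      zero    = sym (zeroʳ _)
    ⟦◃⟧ℤ Sign.+ (suc k) = sym (*-identityˡ _)
    ⟦◃⟧ℤ Sign.- (suc k) = trans (-‿cong (sym (*-identityˡ _))) (-‿distribˡ-* _ _)

    ⟦sign⟧ℤ : ∀ i → ⟦ i ⟧ℤ ≈ ⟦ sign i ⟧ₛ * ι ∣ i ∣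
    ⟦sign⟧ℤ i = trans (reflexive (≡.cong ⟦_⟧ℤ (≡.sym (ℤP.◃-inverse i)))) (⟦◃⟧ℤ (sign i) ∣ i ∣)

    interchange : ∀ p q r s → (p * q) * (r * s) ≈ (p * r) * (q * s)
    interchange p q r s = begin
      (p * q) * (r * s)  ≈⟨ *-assoc _ _ _ ⟩
      p * (q * (r * s))  ≈⟨ *-congˡ (sym (*-assoc _ _ _)) ⟩
      p * ((q * r) * s)  ≈⟨ *-congˡ (*-congʳ (*-comm _ _)) ⟩
      p * ((r * q) * s)  ≈⟨ *-congˡ (*-assoc _ _ _) ⟩
      p * (r * (q * s))  ≈⟨ sym (*-assoc _ _ _) ⟩
      (p * r) * (q * s)  ∎

    ⟦*⟧ℤ : ∀ i j → ⟦ i ℤ.* j ⟧ℤ ≈ ⟦ i ⟧ℤ * ⟦ j ⟧ℤ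
    ⟦*⟧ℤ i j = begin
      ⟦ sign i Sign.* sign j ◃ ∣ i ∣ ℕ.* ∣ j ∣ ⟧ℤ
        ≈⟨ ⟦◃⟧ℤ (sign i Sign.* sign j) (∣ i ∣ ℕ.* ∣ j ∣) ⟩
      ⟦ sign i Sign.* sign j ⟧ₛ * ι (∣ i ∣ ℕ.* ∣ j ∣)
        ≈⟨ *-cong (⟦*⟧ₛ (sign i) (sign j)) (ι-* ∣ i ∣ ∣ j ∣) ⟩
      (⟦ sign i ⟧ₛ * ⟦ sign j ⟧ₛ) * (ι ∣ i ∣ * ι ∣ j ∣)
        ≈⟨ interchange _ _ _ _ ⟩
      (⟦ sign i ⟧ₛ * ι ∣ i ∣) * (⟦ sign j ⟧ₛ * ι ∣ j ∣)
        ≈⟨ sym (*-cong (⟦sign⟧ℤ i) (⟦sign⟧ℤ j)) ⟩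
      ⟦ i ⟧ℤ * ⟦ j ⟧ℤ ∎

    -- The coefficient map actually handed to the solver: it agrees with
    -- ⟦_⟧ℤ but sends 0 and 1 to 0# and 1# on the nose, so that the
    -- constants in solver calls are literally the ring's 0# and 1#.
    ι′ : ℕ → Carrier
    ι′ zero          = 0#
    ι′ (suc zero)    = 1#
    ι′ (suc (suc n)) = ι′ (suc n) + 1#

    ι′≈ι : ∀ n → ι′ n ≈ ι n
    ι′≈ι zero          = refl
    ι′≈ι (suc zero)    = sym (+-identityˡ _)
    ι′≈ι (suc (suc n)) = +-congʳ (ι′≈ι (suc n))

    coefficient : ℤ → Carrier
    coefficient (+ n)      = ι′ n
    coefficient -[1+ n ]   = - ι (suc n)

    coefficient≈ : ∀ i → coefficient i ≈ ⟦ i ⟧ℤ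
    coefficient≈ (+ n)    = ι′≈ι n
    coefficient≈ -[1+ n ] = refl

    homomorphism : ℤ.+-*-rawRing -Raw-AlmostCommutative⟶ fromCommutativeRing R
    homomorphism = record
      { ⟦_⟧    = coefficient
      ; +-homo = λ i j → trans (coefficient≈ (i ℤ.+ j))
                           (trans (⟦+⟧ℤ i j) (sym (+-cong (coefficient≈ i) (coefficient≈ j))))
      ; *-homo = λ i j → trans (coefficient≈ (i ℤ.* j))
                           (trans (⟦*⟧ℤ i j) (sym (*-cong (coefficient≈ i) (coefficient≈ j))))
      ; -‿homo = λ i → trans (coefficient≈ (ℤ.- i)) (trans (⟦-⟧ℤ i) (sym (-‿cong (coefficient≈ i))))
      ; 0-homo = refl
      ; 1-homo = refl
      }

    coefficient-equal? : ∀ i j → Maybe (coefficient i ≈ coefficient j)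
    coefficient-equal? i j with i ℤ.≟ j
    ... | yes ≡.refl = just refl
    ... | no _       = nothing

  open import Algebra.Solver.Ring ℤ.+-*-rawRing (fromCommutativeRing R) homomorphism coefficient-equal? public
    using (solve; _:=_; con; _:+_; _:*_; _:-_; :-_)

module FieldLemmas {c ℓ} (F : CharZeroField c ℓ) where
  open CharZeroField F
  open IntegerCoefficients commutativeRing
  open import Relation.Binary.Reasoning.Setoid setoid

  Nonzero : Carrier → Set ℓ
  Nonzero x = ¬ (x ≈ 0#)

  1-nonzero : Nonzero 1#
  1-nonzero 1≈0 = charZero 0 (trans (+-identityˡ 1#) 1≈0)

  factorial-nonzero : ∀ k → Nonzero (ι (k !))
  factorial-nonzero k with k ! | ℕP.1≤n! k
  ... | suc r | _ = charZero r

  factorˡ-nonzero : ∀ {x y} → Nonzero (x * y) → Nonzero x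
  factorˡ-nonzero {x} {y} xy≉0 x≈0 = xy≉0 (trans (*-congʳ x≈0) (zeroˡ y))

  factorʳ-nonzero : ∀ {x y} → Nonzero (x * y) → Nonzero y
  factorʳ-nonzero {x} {y} xy≉0 y≈0 = xy≉0 (trans (*-congˡ y≈0) (zeroʳ x))

  *-nonzero : ∀ {x y} → Nonzero x → Nonzero y → Nonzero (x * y)
  *-nonzero {x} {y} x≉0 y≉0 xy≈0 = x≉0 (begin
    x                  ≈⟨ sym (*-identityʳ x) ⟩
    x * 1#             ≈⟨ *-congˡ (sym (inverseʳ y y≉0)) ⟩
    x * (y * y ⁻¹)     ≈⟨ sym (*-assoc x y (y ⁻¹)) ⟩
    (x * y) * y ⁻¹     ≈⟨ *-congʳ xy≈0 ⟩
    0# * y ⁻¹          ≈⟨ zeroˡ _ ⟩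
    0#                 ∎)

  inverseˡ : ∀ {x} → Nonzero x → x ⁻¹ * x ≈ 1#
  inverseˡ {x} x≉0 = trans (*-comm (x ⁻¹) x) (inverseʳ x x≉0)

  inverse-unique : ∀ {x y} → x * y ≈ 1# → x ⁻¹ ≈ y
  inverse-unique {x} {y} xy≈1 = begin
    x ⁻¹               ≈⟨ sym (*-identityʳ _) ⟩
    x ⁻¹ * 1#          ≈⟨ *-congˡ (sym xy≈1) ⟩
    x ⁻¹ * (x * y)     ≈⟨ sym (*-assoc _ _ _) ⟩
    (x ⁻¹ * x) * y     ≈⟨ *-congʳ (inverseˡ x≉0) ⟩
    1# * y             ≈⟨ *-identityˡ y ⟩
    y                  ∎
    where
    x≉0 : Nonzero x
    x≉0 = factorˡ-nonzero (λ xy≈0 → 1-nonzero (trans (sym xy≈1) xy≈0))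

  -- If x * y ≈ M with M nonzero, then x ⁻¹ ≈ y / M.  All reciprocals of
  -- binomial coefficients below are evaluated this way, against a common
  -- denominator M.
  inverse-via : ∀ {x y M} → Nonzero M → x * y ≈ M → x ⁻¹ ≈ y * M ⁻¹
  inverse-via {x} {y} {M} M≉0 xy≈M = inverse-unique (begin
    x * (y * M ⁻¹)     ≈⟨ sym (*-assoc _ _ _) ⟩
    (x * y) * M ⁻¹     ≈⟨ *-congʳ xy≈M ⟩
    M * M ⁻¹           ≈⟨ inverseʳ M M≉0 ⟩
    1#                 ∎)

  inverse-cong : ∀ {x y} → Nonzero x → x ≈ y → x ⁻¹ ≈ y ⁻¹
  inverse-cong {x} {y} x≉0 x≈y = sym (inverse-unique (trans (*-congʳ (sym x≈y)) (inverseʳ x x≉0)))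

  inverse-nonzero : ∀ {x} → Nonzero x → Nonzero (x ⁻¹)
  inverse-nonzero {x} x≉0 = factorʳ-nonzero (λ xx⁻¹≈0 → 1-nonzero (trans (sym (inverseʳ x x≉0)) xx⁻¹≈0))

  inverse-* : ∀ {x y} → Nonzero x → Nonzero y → (x * y) ⁻¹ ≈ x ⁻¹ * y ⁻¹
  inverse-* {x} {y} x≉0 y≉0 = inverse-unique (begin
    (x * y) * (x ⁻¹ * y ⁻¹)   ≈⟨ solve 4 (λ x y x′ y′ → (x :* y) :* (x′ :* y′) := (x :* x′) :* (y :* y′))
                                   refl x y (x ⁻¹) (y ⁻¹) ⟩
    (x * x ⁻¹) * (y * y ⁻¹)   ≈⟨ *-cong (inverseʳ x x≉0) (inverseʳ y y≉0) ⟩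
    1# * 1#                   ≈⟨ *-identityˡ 1# ⟩
    1#                        ∎)

  inverse-*-via : ∀ {x y z M} → Nonzero M → (x * y) * z ≈ M → x ⁻¹ * y ⁻¹ ≈ z * M ⁻¹
  inverse-*-via {x} {y} {z} {M} M≉0 xyz≈M =
    trans (sym (inverse-* (factorˡ-nonzero xy≉0) (factorʳ-nonzero xy≉0))) (inverse-via M≉0 xyz≈M)
    where
    xy≉0 : Nonzero (x * y)
    xy≉0 = factorˡ-nonzero (λ xyz≈0 → M≉0 (trans (sym xyz≈M) xyz≈0))

  cross-divide : ∀ {u v s t} → Nonzero u → Nonzero v → v * s ≈ u * t → u ⁻¹ * s ≈ v ⁻¹ * t
  cross-divide {u} {v} {s} {t} u≉0 v≉0 vs≈ut = begin
    u ⁻¹ * s                    ≈⟨ *-congˡ (sym (*-identityˡ s)) ⟩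
    u ⁻¹ * (1# * s)             ≈⟨ *-congˡ (*-congʳ (sym (inverseˡ v≉0))) ⟩
    u ⁻¹ * ((v ⁻¹ * v) * s)     ≈⟨ solve 4 (λ u′ v′ v s → u′ :* ((v′ :* v) :* s) := (u′ :* v′) :* (v :* s)) refl (u ⁻¹) (v ⁻¹) v s ⟩
    (u ⁻¹ * v ⁻¹) * (v * s)     ≈⟨ *-congˡ vs≈ut ⟩
    (u ⁻¹ * v ⁻¹) * (u * t)     ≈⟨ solve 4 (λ u′ v′ u t → (u′ :* v′) :* (u :* t) := (u′ :* u) :* (v′ :* t)) refl (u ⁻¹) (v ⁻¹) u t ⟩
    (u ⁻¹ * u) * (v ⁻¹ * t)     ≈⟨ *-congʳ (inverseˡ u≉0) ⟩
    1# * (v ⁻¹ * t)             ≈⟨ *-identityˡ _ ⟩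
    v ⁻¹ * t                    ∎

  *-cancelˡ : ∀ {u s t} → Nonzero u → u * s ≈ u * t → s ≈ t
  *-cancelˡ {u} {s} {t} u≉0 us≈ut = begin
    s                   ≈⟨ sym (*-identityˡ s) ⟩
    1# * s              ≈⟨ *-congʳ (sym (inverseˡ u≉0)) ⟩
    (u ⁻¹ * u) * s      ≈⟨ *-assoc _ _ _ ⟩
    u ⁻¹ * (u * s)      ≈⟨ *-congˡ us≈ut ⟩
    u ⁻¹ * (u * t)      ≈⟨ sym (*-assoc _ _ _) ⟩
    (u ⁻¹ * u) * t      ≈⟨ *-congʳ (inverseˡ u≉0) ⟩
    1# * t              ≈⟨ *-identityˡ t ⟩
    t                   ∎

  sumTo-cong : ∀ n {f g : ℕ → Carrier} → (∀ j → j < n → f j ≈ g j) → sumTo n f ≈ sumTo n g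
  sumTo-cong zero    f≈g = refl
  sumTo-cong (suc n) f≈g = +-cong (sumTo-cong n (λ j j<n → f≈g j (ℕP.m≤n⇒m≤1+n j<n))) (f≈g n ℕP.≤-refl)

  sumTo-*ˡ : ∀ n x (f : ℕ → Carrier) → sumTo n (λ j → x * f j) ≈ x * sumTo n f
  sumTo-*ˡ zero    x f = sym (zeroʳ x)
  sumTo-*ˡ (suc n) x f = trans (+-congʳ (sumTo-*ˡ n x f)) (sym (distribˡ x _ _))

  sumTo-*ʳ : ∀ n x (f : ℕ → Carrier) → sumTo n (λ j → f j * x) ≈ sumTo n f * x
  sumTo-*ʳ zero    x f = sym (zeroˡ x)
  sumTo-*ʳ (suc n) x f = trans (+-congʳ (sumTo-*ʳ n x f)) (sym (distribʳ x _ _))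

module Binomials {c ℓ} (F : CharZeroField c ℓ) where
  open CharZeroField F
  open IntegerCoefficients commutativeRing
  open FieldLemmas F
  open import Relation.Binary.Reasoning.Setoid setoid

  binom-zero : ∀ x → binom x 0 ≈ 1#
  binom-zero x = trans (*-identityˡ _) (inverse-unique (trans (*-identityʳ _) (+-identityˡ 1#)))

  falling-shift : ∀ {x x′} k → x′ ≈ x + 1# → falling x′ (suc k) ≈ x′ * falling x k
  falling-shift {x} {x′} zero    x′≈x+1 = solve 1 (λ x′ → con (+ 1) :* (x′ :- con (+ 0)) := x′ :* con (+ 1)) refl x′
  falling-shift {x} {x′} (suc k) x′≈x+1 = begin
    falling x′ (suc k) * (x′ - (ι k + 1#))        ≈⟨ *-cong (falling-shift k x′≈x+1) (+-congʳ x′≈x+1) ⟩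
    (x′ * falling x k) * ((x + 1#) - (ι k + 1#))  ≈⟨ solve 4 (λ x′ f x i → (x′ :* f) :* ((x :+ con (+ 1)) :- (i :+ con (+ 1)))
                                                                         := x′ :* (f :* (x :- i)))
                                                        refl x′ (falling x k) x (ι k) ⟩
    x′ * (falling x k * (x - ι k))                ∎

  binom-step : ∀ x k → ι (suc k) * binom x (suc k) ≈ binom x k * (x - ι k)
  binom-step x k = begin
    s * (falling x k * (x - ι k) * ι (suc k *ℕ k !) ⁻¹)
      ≈⟨ *-congˡ (*-congˡ (inverse-cong (factorial-nonzero (suc k)) (ι-* (suc k) (k !)))) ⟩
    s * (falling x k * (x - ι k) * (s * f) ⁻¹)
      ≈⟨ *-congˡ (*-congˡ (inverse-* (charZero k) (factorial-nonzero k))) ⟩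
    s * (falling x k * (x - ι k) * (s ⁻¹ * f ⁻¹))
      ≈⟨ solve 5 (λ s s′ F d f′ → s :* (F :* d :* (s′ :* f′)) := (s :* s′) :* ((F :* f′) :* d)) refl s (s ⁻¹) (falling x k) (x - ι k) (f ⁻¹) ⟩
    (s * s ⁻¹) * (binom x k * (x - ι k))
      ≈⟨ *-congʳ (inverseʳ s (charZero k)) ⟩
    1# * (binom x k * (x - ι k))
      ≈⟨ *-identityˡ _ ⟩
    binom x k * (x - ι k) ∎
    where
    s f : Carrier
    s = ι (suc k)
    f = ι (k !)

  descent : ∀ {x x′} k → x′ ≈ x + 1# → (x′ - ι k) * binom x′ k ≈ x′ * binom x k
  descent {x} {x′} k x′≈x+1 = begin
    (x′ - ι k) * (falling x′ k * f)     ≈⟨ solve 3 (λ d F f → d :* (F :* f) := (F :* d) :* f) refl (x′ - ι k) (falling x′ k) f ⟩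
    falling x′ (suc k) * f              ≈⟨ *-congʳ (falling-shift k x′≈x+1) ⟩
    (x′ * falling x k) * f              ≈⟨ *-assoc _ _ _ ⟩
    x′ * (falling x k * f)              ∎
    where
    f : Carrier
    f = ι (k !) ⁻¹

  absorption : ∀ {x x′} k → x′ ≈ x + 1# → ι (suc k) * binom x′ (suc k) ≈ x′ * binom x k
  absorption {x} {x′} k x′≈x+1 = begin
    ι (suc k) * binom x′ (suc k)   ≈⟨ binom-step x′ k ⟩
    binom x′ k * (x′ - ι k)        ≈⟨ *-comm _ _ ⟩
    (x′ - ι k) * binom x′ k        ≈⟨ descent k x′≈x+1 ⟩
    x′ * binom x k                 ∎

  -- Pascal's rule, obtained from absorption and the basic recursion by
  -- cancelling the nonzero factor k+1.
  pascal : ∀ {x x′} k → x′ ≈ x + 1# → binom x′ (suc k) ≈ binom x (suc k) + binom x k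
  pascal {x} {x′} k x′≈x+1 = *-cancelˡ (charZero k) (begin
    s * binom x′ (suc k)                       ≈⟨ absorption k x′≈x+1 ⟩
    x′ * binom x k                             ≈⟨ *-congʳ x′≈x+1 ⟩
    (x + 1#) * binom x k                       ≈⟨ solve 3 (λ x i B → (x :+ con (+ 1)) :* B := B :* (x :- i) :+ (i :+ con (+ 1)) :* B)
                                                     refl x (ι k) (binom x k) ⟩
    binom x k * (x - ι k) + s * binom x k      ≈⟨ +-congʳ (sym (binom-step x k)) ⟩
    s * binom x (suc k) + s * binom x k        ≈⟨ sym (distribˡ s _ _) ⟩
    s * (binom x (suc k) + binom x k)          ∎)
    where
    s : Carrier
    s = ι (suc k)

  -- Pascal's rule for reciprocals:
  --   (y′+1) / binom y j = y′ (1 / binom y′ j + 1 / binom y′ (j+1)).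
  -- Each reciprocal is evaluated against the common denominator y′ binom y j.
  reciprocal-pascal : ∀ {y y′} j → y′ ≈ y + 1# → Nonzero (y′ * binom y j) →
    (y′ + 1#) * binom y j ⁻¹ ≈ y′ * (binom y′ j ⁻¹ + binom y′ (suc j) ⁻¹)
  reciprocal-pascal {y} {y′} j y′≈y+1 M≉0 = begin
    (y′ + 1#) * binom y j ⁻¹                   ≈⟨ *-congˡ (inverse-via M≉0 (*-comm _ _)) ⟩
    (y′ + 1#) * (y′ * δ)                       ≈⟨ solve 3 (λ y′ i δ → (y′ :+ con (+ 1)) :* (y′ :* δ)
                                                                     := y′ :* ((y′ :- i) :* δ :+ (i :+ con (+ 1)) :* δ))
                                                     refl y′ (ι j) δ ⟩
    y′ * ((y′ - ι j) * δ + ι (suc j) * δ)       ≈⟨ *-congˡ (sym (+-cong reciprocal-j reciprocal-suc-j)) ⟩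
    y′ * (binom y′ j ⁻¹ + binom y′ (suc j) ⁻¹)  ∎
    where
    δ : Carrier
    δ = (y′ * binom y j) ⁻¹
    reciprocal-j : binom y′ j ⁻¹ ≈ (y′ - ι j) * δ
    reciprocal-j = inverse-via M≉0 (trans (*-comm _ _) (descent j y′≈y+1))
    reciprocal-suc-j : binom y′ (suc j) ⁻¹ ≈ ι (suc j) * δ
    reciprocal-suc-j = inverse-via M≉0 (trans (*-comm _ _) (absorption j y′≈y+1))

module WeightedSums {c ℓ} (F : CharZeroField c ℓ) where
  open CharZeroField F
  open IntegerCoefficients commutativeRing
  open FieldLemmas F
  open Binomials F
  open import Relation.Binary.Reasoning.Setoid setoid

  partial : Carrier → ℕ → Carrier
  partial x j = sumTo (suc j) (binom x)

  weighted : Carrier → Carrier → ℕ → Carrier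
  weighted x y n = sumTo (suc n) (λ j → partial x j * binom y j ⁻¹)

  partial-pascal : ∀ {x x′} j → x′ ≈ x + 1# → partial x′ (suc j) ≈ partial x (suc j) + partial x j
  partial-pascal {x} {x′} zero x′≈x+1 = begin
    (0# + binom x 0) + binom x′ 1                ≈⟨ +-congˡ (pascal 0 x′≈x+1) ⟩
    (0# + binom x 0) + (binom x 1 + binom x 0)   ≈⟨ solve 2 (λ B₀ B₁ → (con (+ 0) :+ B₀) :+ (B₁ :+ B₀)
                                                                   := ((con (+ 0) :+ B₀) :+ B₁) :+ (con (+ 0) :+ B₀))
                                                       refl (binom x 0) (binom x 1) ⟩
    partial x 1 + partial x 0                    ∎
  partial-pascal {x} {x′} (suc j) x′≈x+1 = begin
    partial x′ (suc j) + binom x′ (suc (suc j))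
      ≈⟨ +-cong (partial-pascal j x′≈x+1) (pascal (suc j) x′≈x+1) ⟩
    (partial x (suc j) + partial x j) + (binom x (suc (suc j)) + binom x (suc j))
      ≈⟨ solve 4 (λ p q r s → (p :+ q) :+ (r :+ s) := (p :+ r) :+ (q :+ s))
           refl (partial x (suc j)) (partial x j) (binom x (suc (suc j))) (binom x (suc j)) ⟩
    partial x (suc (suc j)) + partial x (suc j) ∎

  summation-by-parts : ∀ {x x′} (v : ℕ → Carrier) n → x′ ≈ x + 1# →
    sumTo (suc n) (λ j → partial x j * (v j + v (suc j)))
      ≈ sumTo (suc n) (λ j → partial x′ j * v j) + partial x n * v (suc n)
  summation-by-parts {x} {x′} v zero x′≈x+1 =
    solve 3 (λ p v₀ v₁ → con (+ 0) :+ p :* (v₀ :+ v₁) := (con (+ 0) :+ p :* v₀) :+ p :* v₁)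
      refl (partial x 0) (v 0) (v 1)
  summation-by-parts {x} {x′} v (suc n) x′≈x+1 = begin
    sumTo (suc n) (λ j → partial x j * (v j + v (suc j))) + p₁ * (v (suc n) + v (suc (suc n)))
      ≈⟨ +-congʳ (summation-by-parts v n x′≈x+1) ⟩
    (Σ′ + p₀ * v (suc n)) + p₁ * (v (suc n) + v (suc (suc n)))
      ≈⟨ solve 5 (λ Σ′ p₀ p₁ v₁ v₂ → (Σ′ :+ p₀ :* v₁) :+ p₁ :* (v₁ :+ v₂) := (Σ′ :+ (p₁ :+ p₀) :* v₁) :+ p₁ :* v₂)
           refl Σ′ p₀ p₁ (v (suc n)) (v (suc (suc n))) ⟩
    (Σ′ + (p₁ + p₀) * v (suc n)) + p₁ * v (suc (suc n))
      ≈⟨ +-congʳ (+-congˡ (*-congʳ (sym (partial-pascal n x′≈x+1)))) ⟩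
    (Σ′ + partial x′ (suc n) * v (suc n)) + p₁ * v (suc (suc n)) ∎
    where
    Σ′ p₀ p₁ : Carrier
    Σ′ = sumTo (suc n) (λ j → partial x′ j * v j)
    p₀ = partial x n
    p₁ = partial x (suc n)

  -- Shift rule (reciprocal Pascal summed by parts):
  --   (y′+1) weighted x y n = y′ (weighted x′ y′ n + partial x n / binom y′ (n+1)).
  weighted-shift : ∀ {x x′ y y′} n → x′ ≈ x + 1# → y′ ≈ y + 1# →
    Nonzero y′ → (∀ j → j ≤ n → Nonzero (binom y j)) →
    (y′ + 1#) * weighted x y n ≈ y′ * (weighted x′ y′ n + partial x n * binom y′ (suc n) ⁻¹)
  weighted-shift {x} {x′} {y} {y′} n x′≈x+1 y′≈y+1 y′≉0 binom≉0 = begin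
    (y′ + 1#) * weighted x y n
      ≈⟨ sym (sumTo-*ˡ (suc n) _ _) ⟩
    sumTo (suc n) (λ j → (y′ + 1#) * (partial x j * binom y j ⁻¹))
      ≈⟨ sumTo-cong (suc n) termwise ⟩
    sumTo (suc n) (λ j → y′ * (partial x j * (v j + v (suc j))))
      ≈⟨ sumTo-*ˡ (suc n) _ _ ⟩
    y′ * sumTo (suc n) (λ j → partial x j * (v j + v (suc j)))
      ≈⟨ *-congˡ (summation-by-parts v n x′≈x+1) ⟩
    y′ * (weighted x′ y′ n + partial x n * v (suc n)) ∎
    where
    v : ℕ → Carrier
    v j = binom y′ j ⁻¹
    termwise : ∀ j → j < suc n → (y′ + 1#) * (partial x j * binom y j ⁻¹) ≈ y′ * (partial x j * (v j + v (suc j)))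
    termwise j (s≤s j≤n) = begin
      (y′ + 1#) * (partial x j * binom y j ⁻¹)   ≈⟨ solve 3 (λ a p q → a :* (p :* q) := p :* (a :* q)) refl (y′ + 1#) (partial x j) (binom y j ⁻¹) ⟩
      partial x j * ((y′ + 1#) * binom y j ⁻¹)   ≈⟨ *-congˡ (reciprocal-pascal j y′≈y+1 (*-nonzero y′≉0 (binom≉0 j j≤n))) ⟩
      partial x j * (y′ * (v j + v (suc j)))     ≈⟨ solve 3 (λ a p q → p :* (a :* q) := a :* (p :* q)) refl y′ (partial x j) (v j + v (suc j)) ⟩
      y′ * (partial x j * (v j + v (suc j)))     ∎

  weighted-shift-divided : ∀ {x x′ y y′ y″} n → x′ ≈ x + 1# → y′ ≈ y + 1# → y″ ≈ y′ + 1# →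
    Nonzero y′ → Nonzero y″ → (∀ j → j ≤ n → Nonzero (binom y j)) →
    y″ ⁻¹ * weighted x′ y′ n ≈ y′ ⁻¹ * weighted x y n - y″ ⁻¹ * (partial x n * binom y′ (suc n) ⁻¹)
  weighted-shift-divided {x} {x′} {y} {y′} {y″} n x′≈x+1 y′≈y+1 y″≈y′+1 y′≉0 y″≉0 binom≉0 = begin
    y″ ⁻¹ * W′                      ≈⟨ solve 3 (λ u W′ q → u :* W′ := u :* (W′ :+ q) :- u :* q) refl (y″ ⁻¹) W′ q ⟩
    y″ ⁻¹ * (W′ + q) - y″ ⁻¹ * q    ≈⟨ +-congʳ (sym (cross-divide y′≉0 y″≉0 cleared)) ⟩
    y′ ⁻¹ * W - y″ ⁻¹ * q           ∎
    where
    W W′ q : Carrier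
    W  = weighted x y n
    W′ = weighted x′ y′ n
    q  = partial x n * binom y′ (suc n) ⁻¹
    cleared : y″ * W ≈ y′ * (W′ + q)
    cleared = trans (*-congʳ y″≈y′+1) (weighted-shift n x′≈x+1 y′≈y+1 y′≉0 binom≉0)

module Identity {r ℓ} (F : CharZeroField r ℓ) (a b : CharZeroField.Carrier F)
                (b-ok : CharZeroField.NotNegInt F b) where
  open CharZeroField F
  open IntegerCoefficients commutativeRing
  open FieldLemmas F
  open Binomials F
  open WeightedSums F
  open import Relation.Binary.Reasoning.Setoid setoid

  ι-index : ∀ N {N′} t → N′ ≡ suc N → ι N′ + t ≈ (ι N + t) + 1#
  ι-index N t ≡.refl = solve 2 (λ i t → (i :+ con (+ 1)) :+ t := (i :+ t) :+ con (+ 1)) refl (ι N) t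

  shifted-nonzero : ∀ k → Nonzero (ι (suc k) + b)
  shifted-nonzero k k+b≈0 = b-ok k (begin
    b                              ≈⟨ solve 2 (λ i b → b := (i :+ b) :- i) refl (ι (suc k)) b ⟩
    (ι (suc k) + b) - ι (suc k)    ≈⟨ +-congʳ k+b≈0 ⟩
    0# - ι (suc k)                 ≈⟨ +-identityˡ _ ⟩
    - ι (suc k)                    ∎)

  index-nonzero : ∀ {N k} → N ≡ suc k → Nonzero (ι N + b)
  index-nonzero {k = k} ≡.refl = shifted-nonzero k

  falling-nonzero : ∀ j r → Nonzero (falling (ι (j +ℕ r) + b) j)
  falling-nonzero zero    r = 1-nonzero
  falling-nonzero (suc j) r = *-nonzero lower-factors top-factor
    where
    lower-factors : Nonzero (falling (ι (suc j +ℕ r) + b) j)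
    lower-factors = ≡.subst (λ N → Nonzero (falling (ι N + b) j)) (ℕP.+-suc j r) (falling-nonzero j (suc r))
    top-factor : Nonzero (ι (suc j +ℕ r) + b - ι j)
    top-factor top≈0 = shifted-nonzero r (begin
      ι (suc r) + b                          ≈⟨ solve 3 (λ i ρ b → (ρ :+ con (+ 1)) :+ b := (((i :+ ρ) :+ con (+ 1)) :+ b) :- i)
                                                    refl (ι j) (ι r) b ⟩
      ((ι j + ι r) + 1#) + b - ι j           ≈⟨ +-congʳ (+-congʳ (+-congʳ (sym (ι-+ j r)))) ⟩
      ι (suc j +ℕ r) + b - ι j               ≈⟨ top≈0 ⟩
      0#                                     ∎)

  binom-nonzero : ∀ {j N} → j ≤ N → Nonzero (binom (ι N + b) j)
  binom-nonzero {j} {N} j≤N = *-nonzero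
    (≡.subst (λ N → Nonzero (falling (ι N + b) j)) (ℕP.m+[n∸m]≡n j≤N) (falling-nonzero j (N ∸ j)))
    (inverse-nonzero (factorial-nonzero j))

  X Y : ℕ → Carrier
  X n = ι (2 *ℕ n +ℕ 2) + a
  Y n = ι (2 *ℕ n +ℕ 1) + b

  lhs : ℕ → Carrier
  lhs n = (ι (2 *ℕ n +ℕ 2) + b) ⁻¹ * weighted (X n) (Y n) n

  term : ℕ → Carrier
  term k = (ι (k +ℕ 1) * binom (ι (2 *ℕ k +ℕ 2) + b) (k +ℕ 1)) ⁻¹
             * (binom (ι (2 *ℕ k) + a) k
                + (b * sumTo k (λ j → binom (ι (2 *ℕ k) + a) j)) * (ι (k +ℕ 1) + b) ⁻¹)

  base : lhs 0 ≈ sumTo 1 term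
  base = begin
    Yb ⁻¹ * (0# + (0# + binom (X 0) 0) * binom (Y 0) 0 ⁻¹)
      ≈⟨ *-congˡ (+-congˡ (*-cong (+-congˡ (binom-zero (X 0))) (inverse-unique (trans (*-congʳ (binom-zero (Y 0))) (*-identityʳ 1#))))) ⟩
    Yb ⁻¹ * (0# + (0# + 1#) * 1#)
      ≈⟨ solve 3 (λ u b ε → u :* (con (+ 0) :+ (con (+ 0) :+ con (+ 1)) :* con (+ 1))
                             := con (+ 0) :+ u :* (con (+ 1) :+ (b :* con (+ 0)) :* ε))
           refl (Yb ⁻¹) b ((ι 1 + b) ⁻¹) ⟩
    0# + Yb ⁻¹ * (1# + (b * 0#) * (ι 1 + b) ⁻¹)
      ≈⟨ +-congˡ (*-cong (inverse-cong (shifted-nonzero 1) (sym ι1*binom≈Yb)) (+-congʳ (sym (binom-zero (ι 0 + a))))) ⟩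
    sumTo 1 term ∎
    where
    Yb : Carrier
    Yb = ι 2 + b
    ι1*binom≈Yb : ι 1 * binom Yb 1 ≈ Yb
    ι1*binom≈Yb = begin
      ι 1 * binom Yb 1        ≈⟨ binom-step Yb 0 ⟩
      binom Yb 0 * (Yb - 0#)  ≈⟨ *-congʳ (binom-zero Yb) ⟩
      1# * (Yb - 0#)          ≈⟨ solve 1 (λ y → con (+ 1) :* (y :- con (+ 0)) := y) refl Yb ⟩
      Yb                      ∎

  index-Y₀ : ∀ n → 2 *ℕ n +ℕ 1 ≡ suc n +ℕ n
  index-Y₀ = solve-∀
  index-Y₁ : ∀ n → 2 *ℕ n +ℕ 2 ≡ suc (2 *ℕ n +ℕ 1)
  index-Y₁ = solve-∀
  index-Y₂ : ∀ n → 2 *ℕ suc n +ℕ 1 ≡ suc (2 *ℕ n +ℕ 2)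
  index-Y₂ = solve-∀
  index-Y₃ : ∀ n → 2 *ℕ suc n +ℕ 2 ≡ suc (2 *ℕ suc n +ℕ 1)
  index-Y₃ = solve-∀
  index-X₂ : ∀ n → 2 *ℕ suc n +ℕ 2 ≡ suc (suc (2 *ℕ n +ℕ 2))
  index-X₂ = solve-∀
  index-double : ∀ n → 2 *ℕ n +ℕ 2 ≡ suc n +ℕ suc n
  index-double = solve-∀
  index-term : ∀ n → 2 *ℕ suc n ≡ 2 *ℕ n +ℕ 2
  index-term = solve-∀
  index-succ : ∀ n → suc n +ℕ 1 ≡ suc (suc n)
  index-succ = solve-∀

  -- Passing from n to m = n + 1.  The argument shifts x and y by 1 twice
  -- (weighted-shift-divided), and the leftover terms are evaluated against
  -- the common denominator  M = Y₃ Y₂ Y₁ binom Y₀ m.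
  module Step (n : ℕ) where
    m : ℕ
    m = suc n

    μ : Carrier
    μ = ι m

    Y₀ Y₁ Y₂ Y₃ X₀ X₁ X₂ : Carrier
    Y₀ = Y n
    Y₁ = ι (2 *ℕ n +ℕ 2) + b
    Y₂ = Y m
    Y₃ = ι (2 *ℕ m +ℕ 2) + b
    X₀ = X n
    X₁ = ι (suc (2 *ℕ n +ℕ 2)) + a
    X₂ = X m

    Y₁≈Y₀+1 : Y₁ ≈ Y₀ + 1#
    Y₁≈Y₀+1 = ι-index (2 *ℕ n +ℕ 1) b (index-Y₁ n)
    Y₂≈Y₁+1 : Y₂ ≈ Y₁ + 1#
    Y₂≈Y₁+1 = ι-index (2 *ℕ n +ℕ 2) b (index-Y₂ n)
    Y₃≈Y₂+1 : Y₃ ≈ Y₂ + 1#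
    Y₃≈Y₂+1 = ι-index (2 *ℕ m +ℕ 1) b (index-Y₃ n)
    X₁≈X₀+1 : X₁ ≈ X₀ + 1#
    X₁≈X₀+1 = ι-index (2 *ℕ n +ℕ 2) a ≡.refl
    X₂≈X₁+1 : X₂ ≈ X₁ + 1#
    X₂≈X₁+1 = ι-index (suc (2 *ℕ n +ℕ 2)) a (index-X₂ n)

    Y₁≈ : Y₁ ≈ (μ + μ) + b
    Y₁≈ = +-congʳ (trans (reflexive (≡.cong ι (index-double n))) (ι-+ m m))
    Y₂≈ : Y₂ ≈ ((μ + μ) + b) + 1#
    Y₂≈ = trans Y₂≈Y₁+1 (+-congʳ Y₁≈)
    Y₃≈ : Y₃ ≈ (((μ + μ) + b) + 1#) + 1#
    Y₃≈ = trans Y₃≈Y₂+1 (+-congʳ Y₂≈)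

    Y₁≉0 : Nonzero Y₁
    Y₁≉0 = index-nonzero (index-Y₁ n)
    Y₂≉0 : Nonzero Y₂
    Y₂≉0 = index-nonzero (index-Y₂ n)
    Y₃≉0 : Nonzero Y₃
    Y₃≉0 = index-nonzero (index-Y₃ n)

    m≤2n+1 : m ≤ 2 *ℕ n +ℕ 1
    m≤2n+1 = ≡.subst (m ≤_) (≡.sym (index-Y₀ n)) (ℕP.m≤m+n m n)
    m≤2n+2 : m ≤ 2 *ℕ n +ℕ 2
    m≤2n+2 = ≡.subst (m ≤_) (≡.sym (index-double n)) (ℕP.m≤m+n m m)

    c p P₁ P₂ : Carrier
    c  = binom X₀ m
    p  = partial X₀ n
    P₁ = partial X₀ m
    P₂ = partial X₁ m

    M δ : Carrier
    M = ((Y₃ * Y₂) * Y₁) * binom Y₀ m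
    δ = M ⁻¹

    M≉0 : Nonzero M
    M≉0 = *-nonzero (*-nonzero (*-nonzero Y₃≉0 Y₂≉0) Y₁≉0) (binom-nonzero m≤2n+1)

    descent₁ : (μ + b) * binom Y₁ m ≈ Y₁ * binom Y₀ m
    descent₁ = trans (*-congʳ bottom) (descent m Y₁≈Y₀+1)
      where
      bottom : μ + b ≈ Y₁ - μ
      bottom = trans (solve 2 (λ μ b → μ :+ b := ((μ :+ μ) :+ b) :- μ) refl μ b) (+-congʳ (sym Y₁≈))

    descent₂ : (μ + 1# + b) * binom Y₂ m ≈ Y₂ * binom Y₁ m
    descent₂ = trans (*-congʳ bottom) (descent m Y₂≈Y₁+1)
      where
      bottom : μ + 1# + b ≈ Y₂ - μ
      bottom = trans (solve 2 (λ μ b → μ :+ con (+ 1) :+ b := (((μ :+ μ) :+ b) :+ con (+ 1)) :- μ) refl μ b) (+-congʳ (sym Y₂≈))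

    tail≈M : (Y₃ * Y₂) * ((μ + b) * binom Y₁ m) ≈ M
    tail≈M = trans (*-congˡ descent₁) (sym (*-assoc _ _ _))

    recip₀ : Y₁ ⁻¹ * binom Y₀ m ⁻¹ ≈ (Y₃ * Y₂) * δ
    recip₀ = inverse-*-via M≉0
      (solve 4 (λ y₁ C y₃ y₂ → (y₁ :* C) :* (y₃ :* y₂) := ((y₃ :* y₂) :* y₁) :* C) refl Y₁ (binom Y₀ m) Y₃ Y₂)

    recip₁ : Y₂ ⁻¹ * binom Y₁ (suc m) ⁻¹ ≈ (Y₃ * (μ + 1#)) * δ
    recip₁ = inverse-*-via M≉0 (begin
      (Y₂ * B) * (Y₃ * (μ + 1#))        ≈⟨ solve 4 (λ y₂ B y₃ s → (y₂ :* B) :* (y₃ :* s) := (y₃ :* y₂) :* (s :* B)) refl Y₂ B Y₃ (μ + 1#) ⟩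
      (Y₃ * Y₂) * ((μ + 1#) * B)        ≈⟨ *-congˡ (absorption m Y₁≈Y₀+1) ⟩
      (Y₃ * Y₂) * (Y₁ * binom Y₀ m)     ≈⟨ sym (*-assoc _ _ _) ⟩
      M                                 ∎)
      where
      B : Carrier
      B = binom Y₁ (suc m)

    recip₂ : Y₃ ⁻¹ * binom Y₂ (suc m) ⁻¹ ≈ ((μ + 1#) * (μ + b)) * δ
    recip₂ = inverse-*-via M≉0 (begin
      (Y₃ * B) * ((μ + 1#) * e)          ≈⟨ solve 4 (λ y₃ B s e → (y₃ :* B) :* (s :* e) := y₃ :* ((s :* B) :* e)) refl Y₃ B (μ + 1#) e ⟩
      Y₃ * (((μ + 1#) * B) * e)          ≈⟨ *-congˡ (*-congʳ (absorption m Y₂≈Y₁+1)) ⟩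
      Y₃ * ((Y₂ * binom Y₁ m) * e)       ≈⟨ solve 4 (λ y₃ y₂ C e → y₃ :* ((y₂ :* C) :* e) := (y₃ :* y₂) :* (e :* C)) refl Y₃ Y₂ (binom Y₁ m) e ⟩
      (Y₃ * Y₂) * (e * binom Y₁ m)       ≈⟨ tail≈M ⟩
      M                                  ∎)
      where
      B e : Carrier
      B = binom Y₂ (suc m)
      e = μ + b

    recip-term : (ι (suc m) * binom Y₃ (suc m)) ⁻¹ ≈ ((μ + 1# + b) * (μ + b)) * δ
    recip-term = inverse-via M≉0 (begin
      ((μ + 1#) * binom Y₃ (suc m)) * (e₁ * e₀)   ≈⟨ *-congʳ (absorption m Y₃≈Y₂+1) ⟩
      (Y₃ * binom Y₂ m) * (e₁ * e₀)               ≈⟨ solve 4 (λ y₃ C e₁ e₀ → (y₃ :* C) :* (e₁ :* e₀) := y₃ :* ((e₁ :* C) :* e₀))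
                                                        refl Y₃ (binom Y₂ m) e₁ e₀ ⟩
      Y₃ * ((e₁ * binom Y₂ m) * e₀)               ≈⟨ *-congˡ (*-congʳ descent₂) ⟩
      Y₃ * ((Y₂ * binom Y₁ m) * e₀)               ≈⟨ solve 4 (λ y₃ y₂ C e → y₃ :* ((y₂ :* C) :* e) := (y₃ :* y₂) :* (e :* C)) refl Y₃ Y₂ (binom Y₁ m) e₀ ⟩
      (Y₃ * Y₂) * (e₀ * binom Y₁ m)               ≈⟨ tail≈M ⟩
      M                                           ∎)
      where
      e₀ e₁ : Carrier
      e₀ = μ + b
      e₁ = μ + 1# + b

    term-value : term m ≈ ((μ + b) * δ) * ((μ + 1# + b) * c + (b * p) * 1#)
    term-value = begin
      term m
        ≡⟨ ≡.cong₂ (λ k N → (ι k * binom Y₃ k) ⁻¹ * (binom (ι N + a) m + (b * sumTo m (binom (ι N + a))) * (ι k + b) ⁻¹))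
                   (index-succ n) (index-term n) ⟩
      (ι (suc m) * binom Y₃ (suc m)) ⁻¹ * (c + (b * p) * ε)
        ≈⟨ *-congʳ recip-term ⟩
      ((e₁ * (μ + b)) * δ) * (c + (b * p) * ε)
        ≈⟨ solve 6 (λ e₁ e₀ δ c q ε → ((e₁ :* e₀) :* δ) :* (c :+ q :* ε) := (e₀ :* δ) :* (e₁ :* c :+ q :* (e₁ :* ε)))
             refl e₁ (μ + b) δ c (b * p) ε ⟩
      ((μ + b) * δ) * (e₁ * c + (b * p) * (e₁ * ε))
        ≈⟨ *-congˡ (+-congˡ (*-congˡ (inverseʳ e₁ (shifted-nonzero m)))) ⟩
      ((μ + b) * δ) * (e₁ * c + (b * p) * 1#) ∎
      where
      e₁ ε : Carrier
      e₁ = μ + 1# + b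
      ε = e₁ ⁻¹

    increment : (Y₁ ⁻¹ * (P₁ * binom Y₀ m ⁻¹) - Y₂ ⁻¹ * (P₁ * binom Y₁ (suc m) ⁻¹))
                  - Y₃ ⁻¹ * (P₂ * binom Y₂ (suc m) ⁻¹)
                ≈ term m
    increment = begin
      (Y₁ ⁻¹ * (P₁ * A₀) - Y₂ ⁻¹ * (P₁ * A₁)) - Y₃ ⁻¹ * (P₂ * A₂)
        ≈⟨ solve 8 (λ u₁ u₂ u₃ A₀ A₁ A₂ P₁ P₂ → (u₁ :* (P₁ :* A₀) :- u₂ :* (P₁ :* A₁)) :- u₃ :* (P₂ :* A₂)
                                               := (P₁ :* (u₁ :* A₀) :- P₁ :* (u₂ :* A₁)) :- P₂ :* (u₃ :* A₂))
             refl (Y₁ ⁻¹) (Y₂ ⁻¹) (Y₃ ⁻¹) A₀ A₁ A₂ P₁ P₂ ⟩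
      (P₁ * (Y₁ ⁻¹ * A₀) - P₁ * (Y₂ ⁻¹ * A₁)) - P₂ * (Y₃ ⁻¹ * A₂)
        ≈⟨ +-cong (+-cong (*-congˡ recip₀) (-‿cong (*-congˡ recip₁)))
                  (-‿cong (*-cong (partial-pascal n X₁≈X₀+1) recip₂)) ⟩
      (P₁ * ((Y₃ * Y₂) * δ) - P₁ * ((Y₃ * (μ + 1#)) * δ)) - (P₁ + p) * (((μ + 1#) * (μ + b)) * δ)
        ≈⟨ +-congʳ (+-cong (*-congˡ (*-congʳ (*-cong Y₃≈ Y₂≈))) (-‿cong (*-congˡ (*-congʳ (*-congʳ Y₃≈))))) ⟩
      (P₁ * ((Y₃′ * Y₂′) * δ) - P₁ * ((Y₃′ * (μ + 1#)) * δ)) - (P₁ + p) * (((μ + 1#) * (μ + b)) * δ)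
        ≈⟨ solve 5 (λ μ b p c δ →
             let Y₂′ = ((μ :+ μ) :+ b) :+ con (+ 1)
                 Y₃′ = Y₂′ :+ con (+ 1)
                 P₁  = p :+ c
             in (P₁ :* ((Y₃′ :* Y₂′) :* δ) :- P₁ :* ((Y₃′ :* (μ :+ con (+ 1))) :* δ))
                  :- (P₁ :+ p) :* (((μ :+ con (+ 1)) :* (μ :+ b)) :* δ)
                := ((μ :+ b) :* δ) :* ((μ :+ con (+ 1) :+ b) :* c :+ (b :* p) :* con (+ 1)))
             refl μ b p c δ ⟩
      ((μ + b) * δ) * ((μ + 1# + b) * c + (b * p) * 1#)
        ≈⟨ sym term-value ⟩
      term m ∎
      where
      A₀ A₁ A₂ Y₂′ Y₃′ : Carrier
      A₀ = binom Y₀ m ⁻¹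
      A₁ = binom Y₁ (suc m) ⁻¹
      A₂ = binom Y₂ (suc m) ⁻¹
      Y₂′ = ((μ + μ) + b) + 1#
      Y₃′ = Y₂′ + 1#

    -- lhs (n+1) = lhs n + term (n+1): two applications of the shift rule,
    -- x ↦ x + 1, y ↦ y + 1, take lhs n to lhs (n+1) up to the increment.
    step : lhs m ≈ lhs n + term m
    step = begin
      Y₃ ⁻¹ * weighted X₂ Y₂ m
        ≈⟨ weighted-shift-divided m X₂≈X₁+1 Y₂≈Y₁+1 Y₃≈Y₂+1 Y₂≉0 Y₃≉0
             (λ j j≤m → binom-nonzero (ℕP.≤-trans j≤m m≤2n+2)) ⟩
      Y₂ ⁻¹ * weighted X₁ Y₁ m - Y₃ ⁻¹ * Q₂
        ≈⟨ +-congʳ (weighted-shift-divided m X₁≈X₀+1 Y₁≈Y₀+1 Y₂≈Y₁+1 Y₁≉0 Y₂≉0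
                      (λ j j≤m → binom-nonzero (ℕP.≤-trans j≤m m≤2n+1))) ⟩
      (Y₁ ⁻¹ * (W₀ + P₁ * binom Y₀ m ⁻¹) - Y₂ ⁻¹ * Q₁) - Y₃ ⁻¹ * Q₂
        ≈⟨ solve 6 (λ u₁ W₀ q₀ u₂ Q₁ R → (u₁ :* (W₀ :+ q₀) :- u₂ :* Q₁) :- R := u₁ :* W₀ :+ ((u₁ :* q₀ :- u₂ :* Q₁) :- R))
             refl (Y₁ ⁻¹) W₀ (P₁ * binom Y₀ m ⁻¹) (Y₂ ⁻¹) Q₁ (Y₃ ⁻¹ * Q₂) ⟩
      Y₁ ⁻¹ * W₀ + ((Y₁ ⁻¹ * (P₁ * binom Y₀ m ⁻¹) - Y₂ ⁻¹ * Q₁) - Y₃ ⁻¹ * Q₂)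
        ≈⟨ +-congˡ increment ⟩
      lhs n + term m ∎
      where
      W₀ Q₁ Q₂ : Carrier
      W₀ = weighted X₀ Y₀ n
      Q₁ = P₁ * binom Y₁ (suc m) ⁻¹
      Q₂ = P₂ * binom Y₂ (suc m) ⁻¹

  lhs≈rhs : ∀ n → lhs n ≈ sumTo (suc n) term
  lhs≈rhs zero    = base
  lhs≈rhs (suc n) = trans (Step.step n) (+-congʳ (lhs≈rhs n))

-- The theorem: the inner sums are  partial (2n+2+a) j / binom (2n+1+b) j,
-- so the left-hand side is lhs n.
theorem1 : ∀ {c ℓ} (F : CharZeroField c ℓ) → let open CharZeroField F in
    ∀ (n : ℕ) (a b : Carrier) → NotNegInt b →
    (ι (2 *ℕ n +ℕ 2) + b) ⁻¹
      * sumTo (suc n) (λ j → sumTo (suc j) (λ i →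
          binom (ι (2 *ℕ n +ℕ 2) + a) i * (binom (ι (2 *ℕ n +ℕ 1) + b) j) ⁻¹))
    ≈ sumTo (suc n) (λ k →
        (ι (k +ℕ 1) * binom (ι (2 *ℕ k +ℕ 2) + b) (k +ℕ 1)) ⁻¹
          * (binom (ι (2 *ℕ k) + a) k
             + (b * sumTo k (λ j → binom (ι (2 *ℕ k) + a) j)) * (ι (k +ℕ 1) + b) ⁻¹))
theorem1 F n a b b-ok = begin
  (ι (2 *ℕ n +ℕ 2) + b) ⁻¹ * sumTo (suc n) (λ j → sumTo (suc j) (λ i → binom (X n) i * binom (Y n) j ⁻¹))
    ≈⟨ *-congˡ (sumTo-cong (suc n) (λ j _ → sumTo-*ʳ (suc j) (binom (Y n) j ⁻¹) (binom (X n)))) ⟩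
  lhs n
    ≈⟨ lhs≈rhs n ⟩
  sumTo (suc n) term ∎
  where
  open CharZeroField F
  open FieldLemmas F
  open Identity F a b b-ok
  open import Relation.Binary.Reasoning.Setoid setoid
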